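{- For every derivation in $\{\mathsf{g}\uparrow,\mathsf{b}\uparrow,\mathsf{w}\uparrow\}$ from $W_1$ to $W_4$ there is a derivation of the shape $W_1\xrightarrow{\{\mathsf{g}\uparrow\}}W_2\xrightarrow{\{\mathsf{b}\uparrow\}}W_3\xrightarrow{\{\mathsf{w}\uparrow\}}W_4$ for some structures $W_2,W_3$.
   Context: Atoms: countably many atoms $a,b,\dots$, each atom $a$ having a dual atom $\bar a$ with $\bar{\bar a}=a$. Structures are generated by $S::= a\mid \circ \mid [S,\dots,S]\mid (S,\dots,S)\mid \langle S;\dots;S\rangle \mid ?S\mid !S\mid \bar S$ (par, tensor, seq with at least one argument; unit $\circ$ not an atom), identified modulo the least congruence $=$ making par, tensor, seq associative, par and tensor commutative, $\circ$ a unit for all three, $[R]=(R)=\langle R\rangle=R$, with $\bar\circ=\circ$, $\overline{[R_1,\dots,R_h]}=(\bar R_1,\dots,\bar R_h)$, $\overline{(R_1,\dots,R_h)}=[\bar R_1,\dots,\bar R_h]$, $\overline{\langle R_1;\dots;R_h\rangle}=\langle\bar R_1;\dots;\bar R_h\rangle$, $\overline{?R}=!\bar R$, $\overline{!R}=?\bar R$, $\bar{\bar R}=R$. A context $S\{\;\}$ is a structure with one hole not under negation. A derivation in a rule set is a finite vertical chain of rule instances (each conclusion equal modulo $=$ to the next premise), possibly a single structure; top = premise, bottom = conclusion. Rules (premise $\Rightarrow$ conclusion, any context $S$ and structure $R$): $\mathsf{w}\uparrow$: $S\{!R\}\Rightarrow S\{\circ\}$; $\mathsf{b}\uparrow$: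 $S\{!R\}\Rightarrow S(!R,R)$; $\mathsf{g}\uparrow$: $S\{!R\}\Rightarrow S\{!!R\}$. Notation $X_0\xrightarrow{\mathcal X_1}X_1\xrightarrow{\mathcal X_2}\cdots\xrightarrow{\mathcal X_k}X_k$ denotes a derivation from $X_0$ to $X_k$ obtained by stacking, for each $i$, a derivation from $X_{i-1}$ to $X_i$ using only rules of $\mathcal X_i$ (possibly with no rule instance). -}

module Defs where

open import Data.Nat using (ℕ)
open import Data.Bool using (Bool; not)
open import Data.Product using (Σ; _×_; _,_)
open import Data.Sum using (_⊎_)
open import Relation.Binary.PropositionalEquality using (_≡_)

record Atom : Set where
  constructor atm
  field
    idx : ℕ
    pol : Bool

dualAtom : Atom → Atom
dualAtom (atm n b) = atm n (not b)

-- The n-ary par/tensor/seq (h ≥ 1 arguments) are represented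
-- by binary constructors; since the congruence below makes them associative
-- and [R] = (R) = ⟨R⟩ = R, every n-ary structure corresponds to a nested
-- binary one and vice versa.
infixr 5 [_,_] ⟨_⨾_⟩
data Str : Set where
  at   : Atom → Str
  unit : Str
  [_,_] : Str → Str → Str
  ⦅_,_⦆ : Str → Str → Str
  ⟨_⨾_⟩ : Str → Str → Str
  ¿_   : Str → Str
  !_   : Str → Str
  bar  : Str → Str

infix 4 _≈_
data _≈_ : Str → Str → Set where
  ≈refl  : ∀ {R} → R ≈ R
  ≈sym   : ∀ {R T} → R ≈ T → T ≈ R
  ≈trans : ∀ {R T U} → R ≈ T → T ≈ U → R ≈ U
  par-cong : ∀ {R R' T T'} → R ≈ R' → T ≈ T' → [ R , T ] ≈ [ R' , T' ]
  ten-cong : ∀ {R R' T T'} → R ≈ R' → T ≈ T' → ⦅ R , T ⦆ ≈ ⦅ R' , T' ⦆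
  seq-cong : ∀ {R R' T T'} → R ≈ R' → T ≈ T' → ⟨ R ⨾ T ⟩ ≈ ⟨ R' ⨾ T' ⟩
  wn-cong  : ∀ {R R'} → R ≈ R' → ¿ R ≈ ¿ R'
  oc-cong  : ∀ {R R'} → R ≈ R' → ! R ≈ ! R'
  bar-cong : ∀ {R R'} → R ≈ R' → bar R ≈ bar R'
  par-assoc : ∀ {R T U} → [ [ R , T ] , U ] ≈ [ R , [ T , U ] ]
  ten-assoc : ∀ {R T U} → ⦅ ⦅ R , T ⦆ , U ⦆ ≈ ⦅ R , ⦅ T , U ⦆ ⦆
  seq-assoc : ∀ {R T U} → ⟨ ⟨ R ⨾ T ⟩ ⨾ U ⟩ ≈ ⟨ R ⨾ ⟨ T ⨾ U ⟩ ⟩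
  par-comm : ∀ {R T} → [ R , T ] ≈ [ T , R ]
  ten-comm : ∀ {R T} → ⦅ R , T ⦆ ≈ ⦅ T , R ⦆
  par-unitˡ : ∀ {R} → [ unit , R ] ≈ R
  par-unitʳ : ∀ {R} → [ R , unit ] ≈ R
  ten-unitˡ : ∀ {R} → ⦅ unit , R ⦆ ≈ R
  ten-unitʳ : ∀ {R} → ⦅ R , unit ⦆ ≈ R
  seq-unitˡ : ∀ {R} → ⟨ unit ⨾ R ⟩ ≈ R
  seq-unitʳ : ∀ {R} → ⟨ R ⨾ unit ⟩ ≈ R
  bar-atom : ∀ {a} → bar (at a) ≈ at (dualAtom a)
  bar-unit : bar unit ≈ unit
  bar-par  : ∀ {R T} → bar [ R , T ] ≈ ⦅ bar R , bar T ⦆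
  bar-ten  : ∀ {R T} → bar ⦅ R , T ⦆ ≈ [ bar R , bar T ]
  bar-seq  : ∀ {R T} → bar ⟨ R ⨾ T ⟩ ≈ ⟨ bar R ⨾ bar T ⟩
  bar-wn   : ∀ {R} → bar (¿ R) ≈ ! (bar R)
  bar-oc   : ∀ {R} → bar (! R) ≈ ¿ (bar R)
  bar-bar  : ∀ {R} → bar (bar R) ≈ R

data Ctx : Set where
  hole : Ctx
  parL : Ctx → Str → Ctx
  parR : Str → Ctx → Ctx
  tenL : Ctx → Str → Ctx
  tenR : Str → Ctx → Ctx
  seqL : Ctx → Str → Ctx
  seqR : Str → Ctx → Ctx
  wnC  : Ctx → Ctx
  ocC  : Ctx → Ctx

plug : Ctx → Str → Str
plug hole       R = R
plug (parL S T) R = [ plug S R , T ]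
plug (parR T S) R = [ T , plug S R ]
plug (tenL S T) R = ⦅ plug S R , T ⦆
plug (tenR T S) R = ⦅ T , plug S R ⦆
plug (seqL S T) R = ⟨ plug S R ⨾ T ⟩
plug (seqR T S) R = ⟨ T ⨾ plug S R ⟩
plug (wnC S)    R = ¿ plug S R
plug (ocC S)    R = ! plug S R

data Rule : Set where
  w↑ b↑ g↑ : Rule

data Instance : Rule → Str → Str → Set where
  w↑-inst : ∀ S R → Instance w↑ (plug S (! R)) (plug S unit)
  b↑-inst : ∀ S R → Instance b↑ (plug S (! R)) (plug S ⦅ ! R , R ⦆)
  g↑-inst : ∀ S R → Instance g↑ (plug S (! R)) (plug S (! (! R)))

RuleSet : Set₁
RuleSet = Rule → Set

data Deriv (𝒳 : RuleSet) : Str → Str → Set where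
  single : ∀ {T B} → T ≈ B → Deriv 𝒳 T B
  step   : ∀ {T P C B} (r : Rule) → 𝒳 r → T ≈ P → Instance r P C →
           Deriv 𝒳 C B → Deriv 𝒳 T B

only : Rule → RuleSet
only r r' = r' ≡ r

gbw↑ : RuleSet
gbw↑ r = (r ≡ g↑ ⊎ r ≡ b↑) ⊎ r ≡ w↑

module Submission where

open import Defs
open import Data.Product using (Σ; _×_; _,_; proj₁; proj₂)
open import Relation.Binary.PropositionalEquality using (_≡_; refl)

-- Each rule ρ is replaced by its parallel version Par ρ, which fires ρ at any
-- set of (possibly nested) positions at once. Under a negation the modalities
-- swap, so Par carries a polarity: at ⊖ the rule acts on ?R as it acts on !R
-- at ⊕. A Par ρ step is realised by a derivation in {ρ}, every instance of ρ
-- is a Par ρ step, and Par ρ commutes with = ; hence it suffices to permute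
-- parallel steps. Weakening commutes down past g↑ and b↑. For b↑ followed by
-- g↑, the two copies produced by b↑ are digged independently; digging them
-- both to their common g↑-reduct instead happens before the copy, and the
-- surplus !s are cut away by b↑ and w↑ (!!R ⟶ (!!R, !R) ⟶ (∘, !R) = !R).

≈-deriv : ∀ {𝒳 T' T B} → T' ≈ T → Deriv 𝒳 T B → Deriv 𝒳 T' B
≈-deriv e (single e') = single (≈trans e e')
≈-deriv e (step r x e' i d) = step r x (≈trans e e') i d

deriv-≈ : ∀ {𝒳 T B B'} → Deriv 𝒳 T B → B ≈ B' → Deriv 𝒳 T B'
deriv-≈ (single e') e = single (≈trans e' e)
deriv-≈ (step r x e' i d) e = step r x e' i (deriv-≈ d e)

deriv-resp-≈ : ∀ {𝒳 T T' B B'} → T ≈ T' → B ≈ B' → Deriv 𝒳 T' B' → Deriv 𝒳 T B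
deriv-resp-≈ eT eB d = ≈-deriv eT (deriv-≈ d (≈sym eB))

infixr 5 _++_
_++_ : ∀ {𝒳 T U B} → Deriv 𝒳 T U → Deriv 𝒳 U B → Deriv 𝒳 T B
single e ++ d = ≈-deriv e d
step r x e i d ++ d' = step r x e i (d ++ d')

instance⇒deriv : ∀ {r P C} → Instance r P C → Deriv (only r) P C
instance⇒deriv {r} i = step r refl ≈refl i (single ≈refl)

plug-cong : ∀ S {R R'} → R ≈ R' → plug S R ≈ plug S R'
plug-cong hole e = e
plug-cong (parL S T) e = par-cong (plug-cong S e) ≈refl
plug-cong (parR T S) e = par-cong ≈refl (plug-cong S e)
plug-cong (tenL S T) e = ten-cong (plug-cong S e) ≈refl
plug-cong (tenR T S) e = ten-cong ≈refl (plug-cong S e)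
plug-cong (seqL S T) e = seq-cong (plug-cong S e) ≈refl
plug-cong (seqR T S) e = seq-cong ≈refl (plug-cong S e)
plug-cong (wnC S) e = wn-cong (plug-cong S e)
plug-cong (ocC S) e = oc-cong (plug-cong S e)

infixr 9 _∘ᶜ_
_∘ᶜ_ : Ctx → Ctx → Ctx
hole ∘ᶜ S' = S'
parL S T ∘ᶜ S' = parL (S ∘ᶜ S') T
parR T S ∘ᶜ S' = parR T (S ∘ᶜ S')
tenL S T ∘ᶜ S' = tenL (S ∘ᶜ S') T
tenR T S ∘ᶜ S' = tenR T (S ∘ᶜ S')
seqL S T ∘ᶜ S' = seqL (S ∘ᶜ S') T
seqR T S ∘ᶜ S' = seqR T (S ∘ᶜ S')
wnC S ∘ᶜ S' = wnC (S ∘ᶜ S')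
ocC S ∘ᶜ S' = ocC (S ∘ᶜ S')

plug-∘ᶜ : ∀ S S' R → plug S (plug S' R) ≡ plug (S ∘ᶜ S') R
plug-∘ᶜ hole S' R = refl
plug-∘ᶜ (parL S T) S' R rewrite plug-∘ᶜ S S' R = refl
plug-∘ᶜ (parR T S) S' R rewrite plug-∘ᶜ S S' R = refl
plug-∘ᶜ (tenL S T) S' R rewrite plug-∘ᶜ S S' R = refl
plug-∘ᶜ (tenR T S) S' R rewrite plug-∘ᶜ S S' R = refl
plug-∘ᶜ (seqL S T) S' R rewrite plug-∘ᶜ S S' R = refl
plug-∘ᶜ (seqR T S) S' R rewrite plug-∘ᶜ S S' R = refl
plug-∘ᶜ (wnC S) S' R rewrite plug-∘ᶜ S S' R = refl
plug-∘ᶜ (ocC S) S' R rewrite plug-∘ᶜ S S' R = refl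

instance-plug : ∀ S {r P C} → Instance r P C → Instance r (plug S P) (plug S C)
instance-plug S (w↑-inst S' R)
  rewrite plug-∘ᶜ S S' (! R) | plug-∘ᶜ S S' unit = w↑-inst (S ∘ᶜ S') R
instance-plug S (b↑-inst S' R)
  rewrite plug-∘ᶜ S S' (! R) | plug-∘ᶜ S S' ⦅ ! R , R ⦆ = b↑-inst (S ∘ᶜ S') R
instance-plug S (g↑-inst S' R)
  rewrite plug-∘ᶜ S S' (! R) | plug-∘ᶜ S S' (! (! R)) = g↑-inst (S ∘ᶜ S') R

deriv-plug : ∀ S {𝒳 T B} → Deriv 𝒳 T B → Deriv 𝒳 (plug S T) (plug S B)
deriv-plug S (single e) = single (plug-cong S e)
deriv-plug S (step r x e i d) = step r x (plug-cong S e) (instance-plug S i) (deriv-plug S d)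

deriv-par : ∀ {𝒳 A A' B B'} → Deriv 𝒳 A A' → Deriv 𝒳 B B' → Deriv 𝒳 [ A , B ] [ A' , B' ]
deriv-par {A' = A'} {B = B} d d' = deriv-plug (parL hole B) d ++ deriv-plug (parR A' hole) d'

deriv-ten : ∀ {𝒳 A A' B B'} → Deriv 𝒳 A A' → Deriv 𝒳 B B' → Deriv 𝒳 ⦅ A , B ⦆ ⦅ A' , B' ⦆
deriv-ten {A' = A'} {B = B} d d' = deriv-plug (tenL hole B) d ++ deriv-plug (tenR A' hole) d'

deriv-seq : ∀ {𝒳 A A' B B'} → Deriv 𝒳 A A' → Deriv 𝒳 B B' → Deriv 𝒳 ⟨ A ⨾ B ⟩ ⟨ A' ⨾ B' ⟩
deriv-seq {A' = A'} {B = B} d d' = deriv-plug (seqL hole B) d ++ deriv-plug (seqR A' hole) d'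

deriv-¿ : ∀ {𝒳 A A'} → Deriv 𝒳 A A' → Deriv 𝒳 (¿ A) (¿ A')
deriv-¿ = deriv-plug (wnC hole)

deriv-! : ∀ {𝒳 A A'} → Deriv 𝒳 A A' → Deriv 𝒳 (! A) (! A')
deriv-! = deriv-plug (ocC hole)

-- Parallel rule application

data Pol : Set where
  ⊕ ⊖ : Pol

neg : Pol → Pol
neg ⊕ = ⊖
neg ⊖ = ⊕

data Par : Rule → Pol → Str → Str → Set where
  c-at   : ∀ {k p a} → Par k p (at a) (at a)
  c-unit : ∀ {k p} → Par k p unit unit
  c-par  : ∀ {k p A A' B B'} → Par k p A A' → Par k p B B' → Par k p [ A , B ] [ A' , B' ]
  c-ten  : ∀ {k p A A' B B'} → Par k p A A' → Par k p B B' → Par k p ⦅ A , B ⦆ ⦅ A' , B' ⦆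
  c-seq  : ∀ {k p A A' B B'} → Par k p A A' → Par k p B B' → Par k p ⟨ A ⨾ B ⟩ ⟨ A' ⨾ B' ⟩
  c-wn   : ∀ {k p A A'} → Par k p A A' → Par k p (¿ A) (¿ A')
  c-oc   : ∀ {k p A A'} → Par k p A A' → Par k p (! A) (! A')
  c-bar  : ∀ {k p A A'} → Par k (neg p) A A' → Par k p (bar A) (bar A')
  w⁺ : ∀ {R} → Par w↑ ⊕ (! R) unit
  w⁻ : ∀ {R} → Par w↑ ⊖ (¿ R) unit
  g⁺ : ∀ {R X} → Par g↑ ⊕ (! R) X → Par g↑ ⊕ (! R) (! X)
  g⁻ : ∀ {R X} → Par g↑ ⊖ (¿ R) X → Par g↑ ⊖ (¿ R) (¿ X)
  b⁺ : ∀ {R X Y} → Par b↑ ⊕ (! R) X → Par b↑ ⊕ R Y → Par b↑ ⊕ (! R) ⦅ X , Y ⦆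
  b⁻ : ∀ {R X Y} → Par b↑ ⊖ (¿ R) X → Par b↑ ⊖ R Y → Par b↑ ⊖ (¿ R) [ X , Y ]

Par-refl : ∀ {k} p A → Par k p A A
Par-refl p (at a) = c-at
Par-refl p unit = c-unit
Par-refl p [ A , B ] = c-par (Par-refl p A) (Par-refl p B)
Par-refl p ⦅ A , B ⦆ = c-ten (Par-refl p A) (Par-refl p B)
Par-refl p ⟨ A ⨾ B ⟩ = c-seq (Par-refl p A) (Par-refl p B)
Par-refl p (¿ A) = c-wn (Par-refl p A)
Par-refl p (! A) = c-oc (Par-refl p A)
Par-refl p (bar A) = c-bar (Par-refl (neg p) A)

Par-plug : ∀ {k X Y} S → Par k ⊕ X Y → Par k ⊕ (plug S X) (plug S Y)
Par-plug hole r = r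
Par-plug (parL S T) r = c-par (Par-plug S r) (Par-refl ⊕ T)
Par-plug (parR T S) r = c-par (Par-refl ⊕ T) (Par-plug S r)
Par-plug (tenL S T) r = c-ten (Par-plug S r) (Par-refl ⊕ T)
Par-plug (tenR T S) r = c-ten (Par-refl ⊕ T) (Par-plug S r)
Par-plug (seqL S T) r = c-seq (Par-plug S r) (Par-refl ⊕ T)
Par-plug (seqR T S) r = c-seq (Par-refl ⊕ T) (Par-plug S r)
Par-plug (wnC S) r = c-wn (Par-plug S r)
Par-plug (ocC S) r = c-oc (Par-plug S r)

instance⇒Par : ∀ {r P C} → Instance r P C → Par r ⊕ P C
instance⇒Par (w↑-inst S R) = Par-plug S w⁺
instance⇒Par (b↑-inst S R) = Par-plug S (b⁺ (Par-refl ⊕ (! R)) (Par-refl ⊕ R))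
instance⇒Par (g↑-inst S R) = Par-plug S (g⁺ (Par-refl ⊕ (! R)))

Par⇒deriv : ∀ {k A B} → Par k ⊕ A B → Deriv (only k) A B
Par⁻⇒deriv-bar : ∀ {k A B} → Par k ⊖ A B → Deriv (only k) (bar A) (bar B)
Par⇒deriv c-at = single ≈refl
Par⇒deriv c-unit = single ≈refl
Par⇒deriv (c-par r s) = deriv-par (Par⇒deriv r) (Par⇒deriv s)
Par⇒deriv (c-ten r s) = deriv-ten (Par⇒deriv r) (Par⇒deriv s)
Par⇒deriv (c-seq r s) = deriv-seq (Par⇒deriv r) (Par⇒deriv s)
Par⇒deriv (c-wn r) = deriv-¿ (Par⇒deriv r)
Par⇒deriv (c-oc r) = deriv-! (Par⇒deriv r)
Par⇒deriv (c-bar r) = Par⁻⇒deriv-bar r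
Par⇒deriv (w⁺ {R}) = instance⇒deriv (w↑-inst hole R)
Par⇒deriv (g⁺ {R} r) = instance⇒deriv (g↑-inst hole R) ++ deriv-! (Par⇒deriv r)
Par⇒deriv (b⁺ {R} r s) = instance⇒deriv (b↑-inst hole R) ++ deriv-ten (Par⇒deriv r) (Par⇒deriv s)
Par⁻⇒deriv-bar c-at = single ≈refl
Par⁻⇒deriv-bar c-unit = single ≈refl
Par⁻⇒deriv-bar (c-par r s) =
  deriv-resp-≈ bar-par bar-par (deriv-ten (Par⁻⇒deriv-bar r) (Par⁻⇒deriv-bar s))
Par⁻⇒deriv-bar (c-ten r s) =
  deriv-resp-≈ bar-ten bar-ten (deriv-par (Par⁻⇒deriv-bar r) (Par⁻⇒deriv-bar s))
Par⁻⇒deriv-bar (c-seq r s) =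
  deriv-resp-≈ bar-seq bar-seq (deriv-seq (Par⁻⇒deriv-bar r) (Par⁻⇒deriv-bar s))
Par⁻⇒deriv-bar (c-wn r) = deriv-resp-≈ bar-wn bar-wn (deriv-! (Par⁻⇒deriv-bar r))
Par⁻⇒deriv-bar (c-oc r) = deriv-resp-≈ bar-oc bar-oc (deriv-¿ (Par⁻⇒deriv-bar r))
Par⁻⇒deriv-bar (c-bar r) = deriv-resp-≈ bar-bar bar-bar (Par⇒deriv r)
Par⁻⇒deriv-bar (w⁻ {R}) = deriv-resp-≈ bar-wn bar-unit (instance⇒deriv (w↑-inst hole (bar R)))
Par⁻⇒deriv-bar (g⁻ {R} r) = deriv-resp-≈ bar-wn bar-wn
  (instance⇒deriv (g↑-inst hole (bar R))
    ++ deriv-resp-≈ (oc-cong (≈sym bar-wn)) ≈refl (deriv-! (Par⁻⇒deriv-bar r)))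
Par⁻⇒deriv-bar (b⁻ {R} r s) = deriv-resp-≈ bar-wn bar-par
  (instance⇒deriv (b↑-inst hole (bar R))
    ++ deriv-resp-≈ (ten-cong (≈sym bar-wn) ≈refl) ≈refl
         (deriv-ten (Par⁻⇒deriv-bar r) (Par⁻⇒deriv-bar s)))

-- Parallel steps commute with =

Transfer : Str → Str → Set
Transfer A A' = ∀ {k p B} → Par k p A B → Σ Str λ B' → Par k p A' B' × B ≈ B'

Transfers : Str → Str → Set
Transfers A A' = Transfer A A' × Transfer A' A

transfer-refl : ∀ {A} → Transfer A A
transfer-refl r = _ , r , ≈refl

transfer-trans : ∀ {A B C} → Transfer A B → Transfer B C → Transfer A C
transfer-trans f g r with f r
... | _ , r₁ , e₁ with g r₁
... | _ , r₂ , e₂ = _ , r₂ , ≈trans e₁ e₂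

transfer-par : ∀ {A A' B B'} → Transfer A A' → Transfer B B' → Transfer [ A , B ] [ A' , B' ]
transfer-par f g (c-par r s) with f r | g s
... | _ , r' , e | _ , s' , e' = _ , c-par r' s' , par-cong e e'

transfer-ten : ∀ {A A' B B'} → Transfer A A' → Transfer B B' → Transfer ⦅ A , B ⦆ ⦅ A' , B' ⦆
transfer-ten f g (c-ten r s) with f r | g s
... | _ , r' , e | _ , s' , e' = _ , c-ten r' s' , ten-cong e e'

transfer-seq : ∀ {A A' B B'} → Transfer A A' → Transfer B B' → Transfer ⟨ A ⨾ B ⟩ ⟨ A' ⨾ B' ⟩
transfer-seq f g (c-seq r s) with f r | g s
... | _ , r' , e | _ , s' , e' = _ , c-seq r' s' , seq-cong e e'

transfer-bar : ∀ {A A'} → Transfer A A' → Transfer (bar A) (bar A')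
transfer-bar f (c-bar r) with f r
... | _ , r' , e = _ , c-bar r' , bar-cong e

transfer-! : ∀ {A A'} → Transfer A A' → Transfer (! A) (! A')
transfer-! f (c-oc r) with f r
... | _ , r' , e = _ , c-oc r' , oc-cong e
transfer-! f w⁺ = _ , w⁺ , ≈refl
transfer-! f (g⁺ r) with transfer-! f r
... | _ , r' , e = _ , g⁺ r' , oc-cong e
transfer-! f (b⁺ r s) with transfer-! f r | f s
... | _ , r' , e | _ , s' , e' = _ , b⁺ r' s' , ten-cong e e'

transfer-¿ : ∀ {A A'} → Transfer A A' → Transfer (¿ A) (¿ A')
transfer-¿ f (c-wn r) with f r
... | _ , r' , e = _ , c-wn r' , wn-cong e
transfer-¿ f w⁻ = _ , w⁻ , ≈refl
transfer-¿ f (g⁻ r) with transfer-¿ f r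
... | _ , r' , e = _ , g⁻ r' , wn-cong e
transfer-¿ f (b⁻ r s) with transfer-¿ f r | f s
... | _ , r' , e | _ , s' , e' = _ , b⁻ r' s' , par-cong e e'

¿⁻⇒!bar⁺ : ∀ {k R Y} → Par k ⊖ (¿ R) Y → Σ Str λ Y' → Par k ⊕ (! (bar R)) Y' × bar Y ≈ Y'
¿⁻⇒!bar⁺ (c-wn r) = _ , c-oc (c-bar r) , bar-wn
¿⁻⇒!bar⁺ w⁻ = _ , w⁺ , bar-unit
¿⁻⇒!bar⁺ (g⁻ r) with ¿⁻⇒!bar⁺ r
... | _ , r' , e = _ , g⁺ r' , ≈trans bar-wn (oc-cong e)
¿⁻⇒!bar⁺ (b⁻ r s) with ¿⁻⇒!bar⁺ r
... | _ , r' , e = _ , b⁺ r' (c-bar s) , ≈trans bar-par (ten-cong e ≈refl)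

!bar⁺⇒¿⁻ : ∀ {k R Y} → Par k ⊕ (! (bar R)) Y → Σ Str λ Z → Par k ⊖ (¿ R) Z × Y ≈ bar Z
!bar⁺⇒¿⁻ (c-oc (c-bar r)) = _ , c-wn r , ≈sym bar-wn
!bar⁺⇒¿⁻ w⁺ = _ , w⁻ , ≈sym bar-unit
!bar⁺⇒¿⁻ (g⁺ r) with !bar⁺⇒¿⁻ r
... | _ , r' , e = _ , g⁻ r' , ≈trans (oc-cong e) (≈sym bar-wn)
!bar⁺⇒¿⁻ (b⁺ r (c-bar s)) with !bar⁺⇒¿⁻ r
... | _ , r' , e = _ , b⁻ r' s , ≈trans (ten-cong e ≈refl) (≈sym bar-par)

!⁺⇒¿bar⁻ : ∀ {k R Y} → Par k ⊕ (! R) Y → Σ Str λ Y' → Par k ⊖ (¿ (bar R)) Y' × bar Y ≈ Y'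
!⁺⇒¿bar⁻ (c-oc r) = _ , c-wn (c-bar r) , bar-oc
!⁺⇒¿bar⁻ w⁺ = _ , w⁻ , bar-unit
!⁺⇒¿bar⁻ (g⁺ r) with !⁺⇒¿bar⁻ r
... | _ , r' , e = _ , g⁻ r' , ≈trans bar-oc (wn-cong e)
!⁺⇒¿bar⁻ (b⁺ r s) with !⁺⇒¿bar⁻ r
... | _ , r' , e = _ , b⁻ r' (c-bar s) , ≈trans bar-ten (par-cong e ≈refl)

¿bar⁻⇒!⁺ : ∀ {k R Y} → Par k ⊖ (¿ (bar R)) Y → Σ Str λ Z → Par k ⊕ (! R) Z × Y ≈ bar Z
¿bar⁻⇒!⁺ (c-wn (c-bar r)) = _ , c-oc r , ≈sym bar-oc
¿bar⁻⇒!⁺ w⁻ = _ , w⁺ , ≈sym bar-unit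
¿bar⁻⇒!⁺ (g⁻ r) with ¿bar⁻⇒!⁺ r
... | _ , r' , e = _ , g⁺ r' , ≈trans (wn-cong e) (≈sym bar-oc)
¿bar⁻⇒!⁺ (b⁻ r (c-bar s)) with ¿bar⁻⇒!⁺ r
... | _ , r' , e = _ , b⁺ r' s , ≈trans (par-cong e ≈refl) (≈sym bar-ten)

bar-¿-transfers : ∀ {R} → Transfers (bar (¿ R)) (! (bar R))
bar-¿-transfers = forth , back
  where
  forth : Transfer (bar (¿ _)) (! (bar _))
  forth {p = ⊕} (c-bar r) = ¿⁻⇒!bar⁺ r
  forth {p = ⊖} (c-bar (c-wn r)) = _ , c-oc (c-bar r) , bar-wn
  back : Transfer (! (bar _)) (bar (¿ _))
  back {p = ⊕} r with !bar⁺⇒¿⁻ r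
  ... | _ , r' , e = _ , c-bar r' , e
  back {p = ⊖} (c-oc (c-bar r)) = _ , c-bar (c-wn r) , ≈sym bar-wn

bar-!-transfers : ∀ {R} → Transfers (bar (! R)) (¿ (bar R))
bar-!-transfers = forth , back
  where
  forth : Transfer (bar (! _)) (¿ (bar _))
  forth {p = ⊖} (c-bar r) = !⁺⇒¿bar⁻ r
  forth {p = ⊕} (c-bar (c-oc r)) = _ , c-wn (c-bar r) , bar-oc
  back : Transfer (¿ (bar _)) (bar (! _))
  back {p = ⊖} r with ¿bar⁻⇒!⁺ r
  ... | _ , r' , e = _ , c-bar r' , e
  back {p = ⊕} (c-wn (c-bar r)) = _ , c-bar (c-oc r) , ≈sym bar-oc

bar-bar-transfers : ∀ {R} → Transfers (bar (bar R)) R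
bar-bar-transfers = forth , back
  where
  forth : Transfer (bar (bar _)) _
  forth {p = ⊕} (c-bar (c-bar r)) = _ , r , bar-bar
  forth {p = ⊖} (c-bar (c-bar r)) = _ , r , bar-bar
  back : Transfer _ (bar (bar _))
  back {p = ⊕} r = _ , c-bar (c-bar r) , ≈sym bar-bar
  back {p = ⊖} r = _ , c-bar (c-bar r) , ≈sym bar-bar

≈⇒transfers : ∀ {A A'} → A ≈ A' → Transfers A A'
≈⇒transfers ≈refl = transfer-refl , transfer-refl
≈⇒transfers (≈sym e) = proj₂ (≈⇒transfers e) , proj₁ (≈⇒transfers e)
≈⇒transfers (≈trans e e') with ≈⇒transfers e | ≈⇒transfers e'
... | f , f′ | g , g′ = transfer-trans f g , transfer-trans g′ f′
≈⇒transfers (par-cong e e') with ≈⇒transfers e | ≈⇒transfers e'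
... | f , f′ | g , g′ = transfer-par f g , transfer-par f′ g′
≈⇒transfers (ten-cong e e') with ≈⇒transfers e | ≈⇒transfers e'
... | f , f′ | g , g′ = transfer-ten f g , transfer-ten f′ g′
≈⇒transfers (seq-cong e e') with ≈⇒transfers e | ≈⇒transfers e'
... | f , f′ | g , g′ = transfer-seq f g , transfer-seq f′ g′
≈⇒transfers (wn-cong e) with ≈⇒transfers e
... | f , f′ = transfer-¿ f , transfer-¿ f′
≈⇒transfers (oc-cong e) with ≈⇒transfers e
... | f , f′ = transfer-! f , transfer-! f′
≈⇒transfers (bar-cong e) with ≈⇒transfers e
... | f , f′ = transfer-bar f , transfer-bar f′
≈⇒transfers par-assoc =
    (λ { (c-par (c-par r s) t) → _ , c-par r (c-par s t) , par-assoc })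
  , (λ { (c-par r (c-par s t)) → _ , c-par (c-par r s) t , ≈sym par-assoc })
≈⇒transfers ten-assoc =
    (λ { (c-ten (c-ten r s) t) → _ , c-ten r (c-ten s t) , ten-assoc })
  , (λ { (c-ten r (c-ten s t)) → _ , c-ten (c-ten r s) t , ≈sym ten-assoc })
≈⇒transfers seq-assoc =
    (λ { (c-seq (c-seq r s) t) → _ , c-seq r (c-seq s t) , seq-assoc })
  , (λ { (c-seq r (c-seq s t)) → _ , c-seq (c-seq r s) t , ≈sym seq-assoc })
≈⇒transfers par-comm =
  (λ { (c-par r s) → _ , c-par s r , par-comm }) , (λ { (c-par r s) → _ , c-par s r , par-comm })
≈⇒transfers ten-comm =
  (λ { (c-ten r s) → _ , c-ten s r , ten-comm }) , (λ { (c-ten r s) → _ , c-ten s r , ten-comm })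
≈⇒transfers par-unitˡ =
  (λ { (c-par c-unit r) → _ , r , par-unitˡ }) , (λ r → _ , c-par c-unit r , ≈sym par-unitˡ)
≈⇒transfers par-unitʳ =
  (λ { (c-par r c-unit) → _ , r , par-unitʳ }) , (λ r → _ , c-par r c-unit , ≈sym par-unitʳ)
≈⇒transfers ten-unitˡ =
  (λ { (c-ten c-unit r) → _ , r , ten-unitˡ }) , (λ r → _ , c-ten c-unit r , ≈sym ten-unitˡ)
≈⇒transfers ten-unitʳ =
  (λ { (c-ten r c-unit) → _ , r , ten-unitʳ }) , (λ r → _ , c-ten r c-unit , ≈sym ten-unitʳ)
≈⇒transfers seq-unitˡ =
  (λ { (c-seq c-unit r) → _ , r , seq-unitˡ }) , (λ r → _ , c-seq c-unit r , ≈sym seq-unitˡ)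
≈⇒transfers seq-unitʳ =
  (λ { (c-seq r c-unit) → _ , r , seq-unitʳ }) , (λ r → _ , c-seq r c-unit , ≈sym seq-unitʳ)
≈⇒transfers bar-atom =
  (λ { (c-bar c-at) → _ , c-at , bar-atom }) , (λ { c-at → _ , c-bar c-at , ≈sym bar-atom })
≈⇒transfers bar-unit =
  (λ { (c-bar c-unit) → _ , c-unit , bar-unit }) , (λ { c-unit → _ , c-bar c-unit , ≈sym bar-unit })
≈⇒transfers bar-par =
    (λ { (c-bar (c-par r s)) → _ , c-ten (c-bar r) (c-bar s) , bar-par })
  , (λ { (c-ten (c-bar r) (c-bar s)) → _ , c-bar (c-par r s) , ≈sym bar-par })
≈⇒transfers bar-ten =
    (λ { (c-bar (c-ten r s)) → _ , c-par (c-bar r) (c-bar s) , bar-ten })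
  , (λ { (c-par (c-bar r) (c-bar s)) → _ , c-bar (c-ten r s) , ≈sym bar-ten })
≈⇒transfers bar-seq =
    (λ { (c-bar (c-seq r s)) → _ , c-seq (c-bar r) (c-bar s) , bar-seq })
  , (λ { (c-seq (c-bar r) (c-bar s)) → _ , c-bar (c-seq r s) , ≈sym bar-seq })
≈⇒transfers bar-wn = bar-¿-transfers
≈⇒transfers bar-oc = bar-!-transfers
≈⇒transfers bar-bar = bar-bar-transfers

transfer : ∀ {A A'} → A ≈ A' → Transfer A A'
transfer e = proj₁ (≈⇒transfers e)

-- Composing and permuting parallel steps

Par-trans : ∀ {k p A B C} → Par k p A B → Par k p B C → Par k p A C
Par-trans c-at c-at = c-at
Par-trans c-unit c-unit = c-unit
Par-trans (c-par r₁ r₂) (c-par s₁ s₂) = c-par (Par-trans r₁ s₁) (Par-trans r₂ s₂)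
Par-trans (c-ten r₁ r₂) (c-ten s₁ s₂) = c-ten (Par-trans r₁ s₁) (Par-trans r₂ s₂)
Par-trans (c-seq r₁ r₂) (c-seq s₁ s₂) = c-seq (Par-trans r₁ s₁) (Par-trans r₂ s₂)
Par-trans (c-wn r) (c-wn s) = c-wn (Par-trans r s)
Par-trans (c-oc r) (c-oc s) = c-oc (Par-trans r s)
Par-trans (c-bar r) (c-bar s) = c-bar (Par-trans r s)
Par-trans (c-oc r) w⁺ = w⁺
Par-trans (c-wn r) w⁻ = w⁻
Par-trans w⁺ c-unit = w⁺
Par-trans w⁻ c-unit = w⁻
Par-trans (g⁺ r) (c-oc s) = g⁺ (Par-trans r s)
Par-trans r@(c-oc _) (g⁺ s) = g⁺ (Par-trans r s)
Par-trans r@(g⁺ _) (g⁺ s) = g⁺ (Par-trans r s)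
Par-trans (g⁻ r) (c-wn s) = g⁻ (Par-trans r s)
Par-trans r@(c-wn _) (g⁻ s) = g⁻ (Par-trans r s)
Par-trans r@(g⁻ _) (g⁻ s) = g⁻ (Par-trans r s)
Par-trans (b⁺ r₁ r₂) (c-ten s₁ s₂) = b⁺ (Par-trans r₁ s₁) (Par-trans r₂ s₂)
Par-trans r@(c-oc r') (b⁺ s₁ s₂) = b⁺ (Par-trans r s₁) (Par-trans r' s₂)
Par-trans (b⁻ r₁ r₂) (c-par s₁ s₂) = b⁻ (Par-trans r₁ s₁) (Par-trans r₂ s₂)
Par-trans r@(c-wn r') (b⁻ s₁ s₂) = b⁻ (Par-trans r s₁) (Par-trans r' s₂)

permute-w↑-g↑ : ∀ {p A B C} → Par w↑ p A B → Par g↑ p B C →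
  Σ Str λ D → Par g↑ p A D × Par w↑ p D C
permute-w↑-g↑ c-at c-at = _ , c-at , c-at
permute-w↑-g↑ c-unit c-unit = _ , c-unit , c-unit
permute-w↑-g↑ (c-par r₁ r₂) (c-par s₁ s₂) with permute-w↑-g↑ r₁ s₁ | permute-w↑-g↑ r₂ s₂
... | _ , u₁ , v₁ | _ , u₂ , v₂ = _ , c-par u₁ u₂ , c-par v₁ v₂
permute-w↑-g↑ (c-ten r₁ r₂) (c-ten s₁ s₂) with permute-w↑-g↑ r₁ s₁ | permute-w↑-g↑ r₂ s₂
... | _ , u₁ , v₁ | _ , u₂ , v₂ = _ , c-ten u₁ u₂ , c-ten v₁ v₂
permute-w↑-g↑ (c-seq r₁ r₂) (c-seq s₁ s₂) with permute-w↑-g↑ r₁ s₁ | permute-w↑-g↑ r₂ s₂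
... | _ , u₁ , v₁ | _ , u₂ , v₂ = _ , c-seq u₁ u₂ , c-seq v₁ v₂
permute-w↑-g↑ (c-wn r) (c-wn s) with permute-w↑-g↑ r s
... | _ , u , v = _ , c-wn u , c-wn v
permute-w↑-g↑ (c-oc r) (c-oc s) with permute-w↑-g↑ r s
... | _ , u , v = _ , c-oc u , c-oc v
permute-w↑-g↑ (c-bar r) (c-bar s) with permute-w↑-g↑ r s
... | _ , u , v = _ , c-bar u , c-bar v
permute-w↑-g↑ (w⁺ {R}) c-unit = _ , Par-refl ⊕ (! R) , w⁺
permute-w↑-g↑ (w⁻ {R}) c-unit = _ , Par-refl ⊖ (¿ R) , w⁻
permute-w↑-g↑ r@(c-oc _) (g⁺ s) with permute-w↑-g↑ r s
... | _ , u , v = _ , g⁺ u , c-oc v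
permute-w↑-g↑ r@(c-wn _) (g⁻ s) with permute-w↑-g↑ r s
... | _ , u , v = _ , g⁻ u , c-wn v

permute-w↑-b↑ : ∀ {p A B C} → Par w↑ p A B → Par b↑ p B C →
  Σ Str λ D → Par b↑ p A D × Par w↑ p D C
permute-w↑-b↑ c-at c-at = _ , c-at , c-at
permute-w↑-b↑ c-unit c-unit = _ , c-unit , c-unit
permute-w↑-b↑ (c-par r₁ r₂) (c-par s₁ s₂) with permute-w↑-b↑ r₁ s₁ | permute-w↑-b↑ r₂ s₂
... | _ , u₁ , v₁ | _ , u₂ , v₂ = _ , c-par u₁ u₂ , c-par v₁ v₂
permute-w↑-b↑ (c-ten r₁ r₂) (c-ten s₁ s₂) with permute-w↑-b↑ r₁ s₁ | permute-w↑-b↑ r₂ s₂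
... | _ , u₁ , v₁ | _ , u₂ , v₂ = _ , c-ten u₁ u₂ , c-ten v₁ v₂
permute-w↑-b↑ (c-seq r₁ r₂) (c-seq s₁ s₂) with permute-w↑-b↑ r₁ s₁ | permute-w↑-b↑ r₂ s₂
... | _ , u₁ , v₁ | _ , u₂ , v₂ = _ , c-seq u₁ u₂ , c-seq v₁ v₂
permute-w↑-b↑ (c-wn r) (c-wn s) with permute-w↑-b↑ r s
... | _ , u , v = _ , c-wn u , c-wn v
permute-w↑-b↑ (c-oc r) (c-oc s) with permute-w↑-b↑ r s
... | _ , u , v = _ , c-oc u , c-oc v
permute-w↑-b↑ (c-bar r) (c-bar s) with permute-w↑-b↑ r s
... | _ , u , v = _ , c-bar u , c-bar v
permute-w↑-b↑ (w⁺ {R}) c-unit = _ , Par-refl ⊕ (! R) , w⁺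
permute-w↑-b↑ (w⁻ {R}) c-unit = _ , Par-refl ⊖ (¿ R) , w⁻
permute-w↑-b↑ r@(c-oc r') (b⁺ s₁ s₂) with permute-w↑-b↑ r s₁ | permute-w↑-b↑ r' s₂
... | _ , u₁ , v₁ | _ , u₂ , v₂ = _ , b⁺ u₁ u₂ , c-ten v₁ v₂
permute-w↑-b↑ r@(c-wn r') (b⁻ s₁ s₂) with permute-w↑-b↑ r s₁ | permute-w↑-b↑ r' s₂
... | _ , u₁ , v₁ | _ , u₂ , v₂ = _ , b⁻ u₁ u₂ , c-par v₁ v₂

g↑-diamond : ∀ {p A D₁ D₂} → Par g↑ p A D₁ → Par g↑ p A D₂ →
  Σ Str λ J → Par g↑ p D₁ J × Par g↑ p D₂ J
g↑-diamond c-at c-at = _ , c-at , c-at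
g↑-diamond c-unit c-unit = _ , c-unit , c-unit
g↑-diamond (c-par r₁ r₂) (c-par s₁ s₂) with g↑-diamond r₁ s₁ | g↑-diamond r₂ s₂
... | _ , u₁ , v₁ | _ , u₂ , v₂ = _ , c-par u₁ u₂ , c-par v₁ v₂
g↑-diamond (c-ten r₁ r₂) (c-ten s₁ s₂) with g↑-diamond r₁ s₁ | g↑-diamond r₂ s₂
... | _ , u₁ , v₁ | _ , u₂ , v₂ = _ , c-ten u₁ u₂ , c-ten v₁ v₂
g↑-diamond (c-seq r₁ r₂) (c-seq s₁ s₂) with g↑-diamond r₁ s₁ | g↑-diamond r₂ s₂
... | _ , u₁ , v₁ | _ , u₂ , v₂ = _ , c-seq u₁ u₂ , c-seq v₁ v₂
g↑-diamond (c-wn r) (c-wn s) with g↑-diamond r s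
... | _ , u , v = _ , c-wn u , c-wn v
g↑-diamond (c-oc r) (c-oc s) with g↑-diamond r s
... | _ , u , v = _ , c-oc u , c-oc v
g↑-diamond (c-bar r) (c-bar s) with g↑-diamond r s
... | _ , u , v = _ , c-bar u , c-bar v
g↑-diamond r@(c-oc _) (g⁺ s) with g↑-diamond r s
... | _ , u , v = _ , g⁺ u , c-oc v
g↑-diamond (g⁺ r) s@(c-oc _) with g↑-diamond r s
... | _ , u , v = _ , c-oc u , g⁺ v
g↑-diamond (g⁺ r) (g⁺ s) with g↑-diamond r s
... | _ , u , v = _ , c-oc u , c-oc v
g↑-diamond r@(c-wn _) (g⁻ s) with g↑-diamond r s
... | _ , u , v = _ , g⁻ u , c-wn v
g↑-diamond (g⁻ r) s@(c-wn _) with g↑-diamond r s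
... | _ , u , v = _ , c-wn u , g⁻ v
g↑-diamond (g⁻ r) (g⁻ s) with g↑-diamond r s
... | _ , u , v = _ , c-wn u , c-wn v

-- Factorisations through g↑, b↑ and w↑

record BW (p : Pol) (A C : Str) : Set where
  constructor bw
  field
    {mid end} : Str
    b-step : Par b↑ p A mid
    w-step : Par w↑ p mid end
    end≈ : end ≈ C

record GBW (p : Pol) (A C : Str) : Set where
  constructor gbw
  field
    {mid₁ mid₂ end} : Str
    g-step : Par g↑ p A mid₁
    b-step : Par b↑ p mid₁ mid₂
    w-step : Par w↑ p mid₂ end
    end≈ : end ≈ C

GBW-refl : ∀ {p} A → GBW p A A
GBW-refl {p} A = gbw (Par-refl p A) (Par-refl p A) (Par-refl p A) ≈refl

GBW-≈ : ∀ {p A X Y} → GBW p A X → X ≈ Y → GBW p A Y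
GBW-≈ (gbw g b w e) e' = gbw g b w (≈trans e e')

GBW-par : ∀ {p A A' B B'} → GBW p A A' → GBW p B B' → GBW p [ A , B ] [ A' , B' ]
GBW-par (gbw g b w e) (gbw g' b' w' e') = gbw (c-par g g') (c-par b b') (c-par w w') (par-cong e e')

GBW-ten : ∀ {p A A' B B'} → GBW p A A' → GBW p B B' → GBW p ⦅ A , B ⦆ ⦅ A' , B' ⦆
GBW-ten (gbw g b w e) (gbw g' b' w' e') = gbw (c-ten g g') (c-ten b b') (c-ten w w') (ten-cong e e')

GBW-seq : ∀ {p A A' B B'} → GBW p A A' → GBW p B B' → GBW p ⟨ A ⨾ B ⟩ ⟨ A' ⨾ B' ⟩
GBW-seq (gbw g b w e) (gbw g' b' w' e') = gbw (c-seq g g') (c-seq b b') (c-seq w w') (seq-cong e e')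

GBW-¿ : ∀ {p A A'} → GBW p A A' → GBW p (¿ A) (¿ A')
GBW-¿ (gbw g b w e) = gbw (c-wn g) (c-wn b) (c-wn w) (wn-cong e)

GBW-! : ∀ {p A A'} → GBW p A A' → GBW p (! A) (! A')
GBW-! (gbw g b w e) = gbw (c-oc g) (c-oc b) (c-oc w) (oc-cong e)

GBW-bar : ∀ {p A A'} → GBW (neg p) A A' → GBW p (bar A) (bar A')
GBW-bar (gbw g b w e) = gbw (c-bar g) (c-bar b) (c-bar w) (bar-cong e)

GBW-dereliction⁺ : ∀ {R Z} → GBW ⊕ R Z → GBW ⊕ (! R) Z
GBW-dereliction⁺ (gbw {D} g b w e) =
  gbw (c-oc g) (b⁺ (Par-refl ⊕ (! D)) b) (c-ten w⁺ w) (≈trans ten-unitˡ e)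

GBW-dereliction⁻ : ∀ {R Z} → GBW ⊖ R Z → GBW ⊖ (¿ R) Z
GBW-dereliction⁻ (gbw {D} g b w e) =
  gbw (c-wn g) (b⁻ (Par-refl ⊖ (¿ D)) b) (c-par w⁻ w) (≈trans par-unitˡ e)

-- A g↑-step added before b↑ and w↑ is undone by one more copy and weakening.
BW-after-g↑ : ∀ {p A J E F} → Par g↑ p A J → Par b↑ p A E → Par w↑ p E F → BW p J F
BW-after-g↑ c-at c-at c-at = bw c-at c-at ≈refl
BW-after-g↑ c-unit c-unit c-unit = bw c-unit c-unit ≈refl
BW-after-g↑ (c-par g₁ g₂) (c-par b₁ b₂) (c-par w₁ w₂)
  with BW-after-g↑ g₁ b₁ w₁ | BW-after-g↑ g₂ b₂ w₂
... | bw u₁ v₁ e₁ | bw u₂ v₂ e₂ = bw (c-par u₁ u₂) (c-par v₁ v₂) (par-cong e₁ e₂)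
BW-after-g↑ (c-ten g₁ g₂) (c-ten b₁ b₂) (c-ten w₁ w₂)
  with BW-after-g↑ g₁ b₁ w₁ | BW-after-g↑ g₂ b₂ w₂
... | bw u₁ v₁ e₁ | bw u₂ v₂ e₂ = bw (c-ten u₁ u₂) (c-ten v₁ v₂) (ten-cong e₁ e₂)
BW-after-g↑ (c-seq g₁ g₂) (c-seq b₁ b₂) (c-seq w₁ w₂)
  with BW-after-g↑ g₁ b₁ w₁ | BW-after-g↑ g₂ b₂ w₂
... | bw u₁ v₁ e₁ | bw u₂ v₂ e₂ = bw (c-seq u₁ u₂) (c-seq v₁ v₂) (seq-cong e₁ e₂)
BW-after-g↑ (c-bar g) (c-bar b) (c-bar w) with BW-after-g↑ g b w
... | bw u v e = bw (c-bar u) (c-bar v) (bar-cong e)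
BW-after-g↑ (c-oc g) (c-oc b) (c-oc w) with BW-after-g↑ g b w
... | bw u v e = bw (c-oc u) (c-oc v) (oc-cong e)
BW-after-g↑ (c-wn g) (c-wn b) (c-wn w) with BW-after-g↑ g b w
... | bw u v e = bw (c-wn u) (c-wn v) (wn-cong e)
BW-after-g↑ (c-oc {A' = J} g) (c-oc b) w⁺ = bw (Par-refl ⊕ (! J)) w⁺ ≈refl
BW-after-g↑ (c-wn {A' = J} g) (c-wn b) w⁻ = bw (Par-refl ⊖ (¿ J)) w⁻ ≈refl
BW-after-g↑ g@(c-oc g') (b⁺ b₁ b₂) (c-ten w₁ w₂)
  with BW-after-g↑ g b₁ w₁ | BW-after-g↑ g' b₂ w₂
... | bw u₁ v₁ e₁ | bw u₂ v₂ e₂ = bw (b⁺ u₁ u₂) (c-ten v₁ v₂) (ten-cong e₁ e₂)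
BW-after-g↑ g@(c-wn g') (b⁻ b₁ b₂) (c-par w₁ w₂)
  with BW-after-g↑ g b₁ w₁ | BW-after-g↑ g' b₂ w₂
... | bw u₁ v₁ e₁ | bw u₂ v₂ e₂ = bw (b⁻ u₁ u₂) (c-par v₁ v₂) (par-cong e₁ e₂)
BW-after-g↑ (g⁺ {X = X} g) b w with BW-after-g↑ g b w
... | bw u v e = bw (b⁺ (Par-refl ⊕ (! X)) u) (c-ten w⁺ v) (≈trans ten-unitˡ e)
BW-after-g↑ (g⁻ {X = X} g) b w with BW-after-g↑ g b w
... | bw u v e = bw (b⁻ (Par-refl ⊖ (¿ X)) u) (c-par w⁻ v) (≈trans par-unitˡ e)

GBW-contraction⁺ : ∀ {R Z₁ Z₂} → GBW ⊕ (! R) Z₁ → GBW ⊕ (! R) Z₂ → GBW ⊕ (! R) ⦅ Z₁ , Z₂ ⦆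
GBW-contraction⁺ (gbw g₁ b₁ w₁ e₁) (gbw g₂ b₂ w₂ e₂) with g↑-diamond g₁ g₂
... | J , j₁ , j₂ with BW-after-g↑ j₁ b₁ w₁ | BW-after-g↑ j₂ b₂ w₂
... | bw u₁ v₁ f₁ | bw u₂ v₂ f₂ =
  gbw (g⁺ (Par-trans g₁ j₁)) (b⁺ (b⁺ (Par-refl ⊕ (! J)) u₁) u₂) (c-ten (c-ten w⁺ v₁) v₂)
      (≈trans (ten-cong ten-unitˡ ≈refl) (ten-cong (≈trans f₁ e₁) (≈trans f₂ e₂)))

GBW-contraction⁻ : ∀ {R Z₁ Z₂} → GBW ⊖ (¿ R) Z₁ → GBW ⊖ (¿ R) Z₂ → GBW ⊖ (¿ R) [ Z₁ , Z₂ ]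
GBW-contraction⁻ (gbw g₁ b₁ w₁ e₁) (gbw g₂ b₂ w₂ e₂) with g↑-diamond g₁ g₂
... | J , j₁ , j₂ with BW-after-g↑ j₁ b₁ w₁ | BW-after-g↑ j₂ b₂ w₂
... | bw u₁ v₁ f₁ | bw u₂ v₂ f₂ =
  gbw (g⁻ (Par-trans g₁ j₁)) (b⁻ (b⁻ (Par-refl ⊖ (¿ J)) u₁) u₂) (c-par (c-par w⁻ v₁) v₂)
      (≈trans (par-cong par-unitˡ ≈refl) (par-cong (≈trans f₁ e₁) (≈trans f₂ e₂)))

permute-b↑-g↑ : ∀ {p A B C} → Par b↑ p A B → Par g↑ p B C → GBW p A C
permute-b↑-g↑ c-at c-at = GBW-refl _
permute-b↑-g↑ c-unit c-unit = GBW-refl _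
permute-b↑-g↑ (c-par r₁ r₂) (c-par s₁ s₂) = GBW-par (permute-b↑-g↑ r₁ s₁) (permute-b↑-g↑ r₂ s₂)
permute-b↑-g↑ (c-ten r₁ r₂) (c-ten s₁ s₂) = GBW-ten (permute-b↑-g↑ r₁ s₁) (permute-b↑-g↑ r₂ s₂)
permute-b↑-g↑ (c-seq r₁ r₂) (c-seq s₁ s₂) = GBW-seq (permute-b↑-g↑ r₁ s₁) (permute-b↑-g↑ r₂ s₂)
permute-b↑-g↑ (c-wn r) (c-wn s) = GBW-¿ (permute-b↑-g↑ r s)
permute-b↑-g↑ (c-oc r) (c-oc s) = GBW-! (permute-b↑-g↑ r s)
permute-b↑-g↑ (c-bar r) (c-bar s) = GBW-bar (permute-b↑-g↑ r s)
permute-b↑-g↑ r@(c-oc _) (g⁺ s) with permute-b↑-g↑ r s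
... | gbw g b w e = gbw (g⁺ g) (c-oc b) (c-oc w) (oc-cong e)
permute-b↑-g↑ r@(c-wn _) (g⁻ s) with permute-b↑-g↑ r s
... | gbw g b w e = gbw (g⁻ g) (c-wn b) (c-wn w) (wn-cong e)
permute-b↑-g↑ (b⁺ r₁ r₂) (c-ten s₁ s₂) =
  GBW-contraction⁺ (permute-b↑-g↑ r₁ s₁) (GBW-dereliction⁺ (permute-b↑-g↑ r₂ s₂))
permute-b↑-g↑ (b⁻ r₁ r₂) (c-par s₁ s₂) =
  GBW-contraction⁻ (permute-b↑-g↑ r₁ s₁) (GBW-dereliction⁻ (permute-b↑-g↑ r₂ s₂))

GBW-then-Par : ∀ {A C} r → GBW ⊕ A C → ∀ {C'} → Par r ⊕ C C' → GBW ⊕ A C'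
GBW-then-Par r (gbw g b w e) x with transfer (≈sym e) x
... | _ , x' , e' = GBW-≈ (extend r g b w x') (≈sym e')
  where
  extend : ∀ r {A D E F C} → Par g↑ ⊕ A D → Par b↑ ⊕ D E → Par w↑ ⊕ E F →
    Par r ⊕ F C → GBW ⊕ A C
  extend w↑ g b w x = gbw g b (Par-trans w x) ≈refl
  extend b↑ g b w x with permute-w↑-b↑ w x
  ... | _ , u , v = gbw g (Par-trans b u) v ≈refl
  extend g↑ g b w x with permute-w↑-g↑ w x
  ... | _ , u , v with permute-b↑-g↑ b u
  ... | gbw g₂ b₂ w₂ e₂ with transfer (≈sym e₂) v
  ... | _ , v' , e = gbw (Par-trans g g₂) b₂ (Par-trans w₂ v') (≈sym e)

GBW-then-deriv : ∀ {A T B} → GBW ⊕ A T → Deriv gbw↑ T B → GBW ⊕ A B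
GBW-then-deriv t (single e) = GBW-≈ t e
GBW-then-deriv t (step r _ e i d) = GBW-then-deriv (GBW-then-Par r (GBW-≈ t e) (instance⇒Par i)) d

lemma4p9 : (W₁ W₄ : Str) → Deriv gbw↑ W₁ W₄ →
    Σ Str λ W₂ → Σ Str λ W₃ →
      Deriv (only g↑) W₁ W₂ × Deriv (only b↑) W₂ W₃ × Deriv (only w↑) W₃ W₄
lemma4p9 W₁ W₄ d with GBW-then-deriv (GBW-refl W₁) d
... | gbw g b w e = _ , _ , Par⇒deriv g , Par⇒deriv b , deriv-≈ (Par⇒deriv w) e
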